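{- Let $e>1$ be a rational number and let $text$ be a string of length $n\ge1$ such that $text[1..n-1]$ is $e$-repetition-free. Let $t$ be the length of the shortest unioccurrent suffix of $text$, i.e. the shortest suffix of $text$ that does not occur as a substring of $text[1..n-1]$. Let $u$ be a substring of $text$ that is an $e$-repetition. Then $t\le |u|<\frac{e}{e-1}\,t$.
   Context: Strings are indexed from $1$. The notation $w[i..j]$ denotes $w[i]w[i+1]\cdots w[j]$, and it is the empty string if $i>j$. An integer $p\ge1$ is a period of $w$ if $w=(uv)^ku$ for some integer $k\ge1$ and strings $u,v$ with $|uv|=p$. A string $w$ is an $e$-repetition if $|w|\ge pe$ for some period $p$ of $w$. A string is $e$-repetition-free if it has no substring that is an $e$-repetition. -}

module Defs where

open import Data.Nat using (ℕ; _≥_; _∸_)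
open import Data.Integer using (+_)
open import Data.Rational using (ℚ; _/_; _*_; _≤_)
open import Data.List using (List; _++_; length; concat; replicate; take)
open import Data.Product using (Σ; _×_; ∃)
open import Relation.Binary.PropositionalEquality using (_≡_)
open import Relation.Nullary using (¬_)

toℚ : ℕ → ℚ
toℚ n = + n / 1

IsPeriod : ∀ {A : Set} → List A → ℕ → Set
IsPeriod {A} w p =
  (p ≥ 1) ×
  Σ (List A) λ u → Σ (List A) λ v → Σ ℕ λ k →
    (k ≥ 1) × (length (u ++ v) ≡ p) × (w ≡ concat (replicate k (u ++ v)) ++ u)

IsRepetition : ∀ {A : Set} → ℚ → List A → Set
IsRepetition e w = Σ ℕ λ p → IsPeriod w p × (toℚ p * e ≤ toℚ (length w))

IsSubstring : ∀ {A : Set} → List A → List A → Set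
IsSubstring {A} u w = Σ (List A) λ x → Σ (List A) λ y → x ++ u ++ y ≡ w

IsSuffix : ∀ {A : Set} → List A → List A → Set
IsSuffix {A} s w = Σ (List A) λ x → x ++ s ≡ w

RepetitionFree : ∀ {A : Set} → ℚ → List A → Set
RepetitionFree e w = ∀ u → IsSubstring u w → ¬ IsRepetition e u

dropLast : ∀ {A : Set} → List A → List A
dropLast w = take (length w ∸ 1) w

IsUnioccurrentSuffix : ∀ {A : Set} → List A → List A → Set
IsUnioccurrentSuffix s text = IsSuffix s text × ¬ IsSubstring s (dropLast text)

IsShortestUnioccurrentSuffixLength : ∀ {A : Set} → List A → ℕ → Set
IsShortestUnioccurrentSuffixLength {A} text t =
  (Σ (List A) λ s → IsUnioccurrentSuffix s text × length s ≡ t) ×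
  (∀ s → IsUnioccurrentSuffix s text → t Data.Nat.≤ length s)

-- Write text = w ∷ʳ c, so that dropLast text = w is e-repetition-free.  A
-- substring of text either occurs in w or is a suffix of text; the e-repetition u
-- cannot occur in w, so u is a unioccurrent suffix and t ≤ |u|.  For the upper
-- bound let p be a period of u with p·e ≤ |u|.  Then u has a border of length
-- |u| − p:  u = front ++ border = border ++ back with |front| = |back| = p ≥ 1.
-- The border is a suffix of text (it ends u) and also occurs in w (inside text it
-- is followed by the non-empty back), so it is shorter than every unioccurrent
-- suffix: |border| < t.  Finally, with r = |border|,
--   |u|(e − 1) = |u|e − |u| ≤ |u|e − pe = e·r < e·t.
module Submission where

open import Defs
open import Data.Nat using (ℕ; _≥_; _≤_)
open import Data.Rational using (ℚ; 1ℚ; _*_; _-_; _<_)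
open import Data.List using (List; length)
open import Data.Product using (_×_)

open import Data.Nat as ℕ using (zero; suc; s≤s; z≤n)
import Data.Nat.Properties as ℕP
open import Data.List using ([]; _∷_; _++_; [_]; _∷ʳ_; concat; replicate; take; initLast; _∷ʳ′_)
open import Data.List.Properties using (++-assoc; ++-identityʳ; length-++; length-++-comm; length-++-≤ʳ; ∷ʳ-injective; ∷-injective)
open import Data.Rational using (_+_)
open import Data.Product using (_,_; proj₁; proj₂)
open import Data.Sum using (_⊎_; inj₁; inj₂)
open import Data.Empty using (⊥-elim)
open import Function using (_∘_)
open import Relation.Nullary using (¬_; yes; no)
open import Relation.Binary.PropositionalEquality using (_≡_; refl; sym; trans; cong; cong₂; subst; module ≡-Reasoning)

module Rationals where
  open import Data.Integer as ℤ using (+_)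
  import Data.Integer.Properties as ℤP
  import Data.Rational as ℚ
  open import Data.Rational using (mkℚ; _+_; Positive; positive; *<*)
  open import Data.Rational.Properties
  import Data.Nat.Coprimality as Coprime
  open import Data.Rational.Solver using (module +-*-Solver)
  open +-*-Solver

  toℚ-mkℚ : ∀ n → toℚ n ≡ mkℚ (+ n) 0 (Coprime.sym (Coprime.1-coprimeTo n))
  toℚ-mkℚ n = normalize-coprime (Coprime.sym (Coprime.1-coprimeTo n))

  toℚ-+ : ∀ m n → toℚ (m ℕ.+ n) ≡ toℚ m + toℚ n
  toℚ-+ m n rewrite toℚ-mkℚ m | toℚ-mkℚ n =
    /-cong {p₁ = + (m ℕ.+ n)} {q₁ = 1}
      (sym (cong₂ ℤ._+_ (ℤP.*-identityʳ (+ m)) (ℤP.*-identityʳ (+ n)))) refl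

  toℚ-< : ∀ {m n} → m ℕ.< n → toℚ m < toℚ n
  toℚ-< {m} {n} m<n rewrite toℚ-mkℚ m | toℚ-mkℚ n =
    *<* (drop-*1 (ℤ.+<+ m<n))
    where
    drop-*1 : + m ℤ.< + n → + m ℤ.* + 1 ℤ.< + n ℤ.* + 1
    drop-*1 lt rewrite ℤP.*-identityʳ (+ m) | ℤP.*-identityʳ (+ n) = lt

  >1⇒positive : ∀ {e} → 1ℚ < e → Positive e
  >1⇒positive 1<e = positive (<-trans (*<* (ℤ.+<+ (s≤s z≤n))) 1<e)

  excess-bound : ∀ U P R T e → Positive e → U ≡ P + R → P * e ℚ.≤ U → R < T →
                 U * (e - 1ℚ) < e * T
  excess-bound U P R T e e>0 refl Pe≤U R<T = begin-strict
    U * (e - 1ℚ)   ≡⟨ solve 3 (λ P R e → (P :+ R) :* (e :- con 1ℚ) := (P :+ R) :* e :- (P :+ R)) refl P R e ⟩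
    U * e - U      ≤⟨ +-monoʳ-≤ (U * e) (neg-antimono-≤ Pe≤U) ⟩
    U * e - P * e  ≡⟨ solve 3 (λ P R e → (P :+ R) :* e :- P :* e := e :* R) refl P R e ⟩
    e * R          <⟨ *-monoʳ-<-pos e {{e>0}} R<T ⟩
    e * T          ∎
    where open ≤-Reasoning

open Rationals using (toℚ-+; toℚ-<; >1⇒positive; excess-bound)

module Words {A : Set} where

  substring-trans : {s r w : List A} → IsSubstring s r → IsSubstring r w → IsSubstring s w
  substring-trans {s} (x , y , refl) (x' , y' , refl) = x' ++ x , y ++ y' , (begin
    (x' ++ x) ++ s ++ y ++ y'  ≡⟨ ++-assoc x' x (s ++ y ++ y') ⟩
    x' ++ x ++ s ++ y ++ y'    ≡⟨ cong (λ z → x' ++ x ++ z) (sym (++-assoc s y y')) ⟩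
    x' ++ x ++ (s ++ y) ++ y'  ≡⟨ cong (x' ++_) (sym (++-assoc x (s ++ y) y')) ⟩
    x' ++ (x ++ s ++ y) ++ y'  ∎)
    where open ≡-Reasoning

  suffix-trans : {s r w : List A} → IsSuffix s r → IsSuffix r w → IsSuffix s w
  suffix-trans {s} (x , refl) (x' , refl) = x' ++ x , ++-assoc x' x s

  suffix⇒substring : {s w : List A} → IsSuffix s w → IsSubstring s w
  suffix⇒substring {s} (x , refl) = x , [] , cong (x ++_) (++-identityʳ s)

  shorter-suffix : (x s x' s' : List A) → x ++ s ≡ x' ++ s' → length s' ≤ length s → IsSuffix s' s
  shorter-suffix []      s x'       s' refl _  = x' , refl
  shorter-suffix (c ∷ x) s []       s' refl le = ⊥-elim (ℕP.<⇒≱ le (length-++-≤ʳ s {x}))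
  shorter-suffix (c ∷ x) s (d ∷ x') s' eq le = shorter-suffix x s x' s' (proj₂ (∷-injective eq)) le

  dropLast-snoc : (w : List A) (a : A) → dropLast (w ∷ʳ a) ≡ w
  dropLast-snoc w a rewrite length-++ w {[ a ]} | ℕP.m+n∸n≡m (length w) 1 = take-prefix w
    where
    take-prefix : (v : List A) → take (length v) (v ++ [ a ]) ≡ v
    take-prefix []      = refl
    take-prefix (b ∷ v) = cong (b ∷_) (take-prefix v)

  occurs-before-end : (w : List A) (a : A) {x u y : List A} → 1 ≤ length y →
                      x ++ u ++ y ≡ w ∷ʳ a → IsSubstring u w
  occurs-before-end w a {x} {u} {y} _ eq with initLast y
  occurs-before-end w a {x} {u} {.[]} () eq | []
  occurs-before-end w a {x} {u} {.(y ∷ʳ b)} _ eq | y ∷ʳ′ b =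
    x , y , proj₁ (∷ʳ-injective (x ++ u ++ y) w (begin
      (x ++ u ++ y) ∷ʳ b    ≡⟨ ++-assoc x (u ++ y) [ b ] ⟩
      x ++ (u ++ y) ∷ʳ b    ≡⟨ cong (x ++_) (++-assoc u y [ b ]) ⟩
      x ++ u ++ y ∷ʳ b      ≡⟨ eq ⟩
      w ∷ʳ a                ∎))
    where open ≡-Reasoning

  substring-of-snoc : (w : List A) (a : A) {u : List A} → IsSubstring u (w ∷ʳ a) →
                      IsSubstring u w ⊎ IsSuffix u (w ∷ʳ a)
  substring-of-snoc w a {u} (x , []    , eq) = inj₂ (x , trans (cong (x ++_) (sym (++-identityʳ u))) eq)
  substring-of-snoc w a     (x , d ∷ y , eq) = inj₁ (occurs-before-end w a {x} {y = d ∷ y} (s≤s z≤n) eq)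

  -- A suffix of text that also occurs in dropLast text is shorter than every
  -- unioccurrent suffix (otherwise that unioccurrent suffix would lie inside it).
  unioccurrent-longer : {r s text : List A} → IsSuffix r text → IsSubstring r (dropLast text) →
                        IsUnioccurrentSuffix s text → length r ℕ.< length s
  unioccurrent-longer {r} {s} (x , r-end) r-occ ((x' , s-end) , s-new) with length s ℕ.≤? length r
  ... | no  |s|≰|r| = ℕP.≰⇒> |s|≰|r|
  ... | yes |s|≤|r| = ⊥-elim (s-new (substring-trans (suffix⇒substring s⊒r) r-occ))
    where
    s⊒r : IsSuffix s r
    s⊒r = shorter-suffix x r x' s (trans r-end (sym s-end)) |s|≤|r|

  power-snoc : ∀ m (q : List A) → concat (replicate (suc m) q) ≡ concat (replicate m q) ++ q
  power-snoc zero    q = ++-identityʳ q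
  power-snoc (suc m) q = trans (cong (q ++_) (power-snoc m q)) (sym (++-assoc q _ q))

  record Border (u : List A) (p : ℕ) : Set where
    field
      border          : List A
      front           : List A
      back            : List A
      u≡front++border : u ≡ front ++ border
      |front|         : length front ≡ p
      u≡border++back  : u ≡ border ++ back
      |back|          : length back ≡ p

  period⇒border : {u : List A} {p : ℕ} → IsPeriod u p → Border u p
  period⇒border (_ , a , b , suc m , _ , |ab| , refl) = record
    { border          = r
    ; front           = a ++ b
    ; back            = b ++ a
    ; u≡front++border = ++-assoc (a ++ b) (concat (replicate m (a ++ b))) a
    ; |front|         = |ab|
    ; u≡border++back  = begin
        concat (replicate (suc m) (a ++ b)) ++ a     ≡⟨ cong (_++ a) (power-snoc m (a ++ b)) ⟩
        (concat (replicate m (a ++ b)) ++ a ++ b) ++ a ≡⟨ ++-assoc (concat (replicate m (a ++ b))) (a ++ b) a ⟩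
        concat (replicate m (a ++ b)) ++ (a ++ b) ++ a ≡⟨ cong (concat (replicate m (a ++ b)) ++_) (++-assoc a b a) ⟩
        concat (replicate m (a ++ b)) ++ a ++ b ++ a   ≡⟨ sym (++-assoc (concat (replicate m (a ++ b))) a (b ++ a)) ⟩
        r ++ b ++ a                                    ∎
    ; |back|          = trans (length-++-comm b a) |ab|
    }
    where
    open ≡-Reasoning
    r : List A
    r = concat (replicate m (a ++ b)) ++ a

open Words

lemma3 : {A : Set} (e : ℚ) → 1ℚ < e → (text : List A) → length text ≥ 1 → RepetitionFree e (dropLast text) → (t : ℕ) → IsShortestUnioccurrentSuffixLength text t → (u : List A) → IsSubstring u text → IsRepetition e u → (t ≤ length u) × (toℚ (length u) * (e - 1ℚ) < e * toℚ t)
lemma3 e 1<e text |text|≥1 free t ((s , s-unioccurrent , |s|≡t) , shortest) u u-occ rep@(p , period , pe≤|u|)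
  with initLast text
... | [] = ⊥-elim (ℕP.<-irrefl refl |text|≥1)
... | w ∷ʳ′ c = t≤|u| , excess-bound (toℚ (length u)) (toℚ p) (toℚ (length border)) (toℚ t) e
                          (>1⇒positive 1<e) |u|≡p+|border| pe≤|u| (toℚ-< |border|<t)
  where
  open Border (period⇒border period)

  u-new : ¬ IsSubstring u (dropLast (w ∷ʳ c))
  u-new occ = free u occ rep

  u-end : IsSuffix u (w ∷ʳ c)
  u-end with substring-of-snoc w c u-occ
  ... | inj₁ in-w = ⊥-elim (u-new (subst (IsSubstring u) (sym (dropLast-snoc w c)) in-w))
  ... | inj₂ end  = end

  t≤|u| : t ≤ length u
  t≤|u| = shortest u (u-end , u-new)

  -- The border ends the text and also occurs in the prefix, followed by back ≠ [].
  border-end : IsSuffix border (w ∷ʳ c)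
  border-end = suffix-trans (front , sym u≡front++border) u-end

  border-occ : IsSubstring border (dropLast (w ∷ʳ c))
  border-occ = subst (IsSubstring border) (sym (dropLast-snoc w c))
    (occurs-before-end w c {proj₁ u-end} {border} {back} (subst (1 ≤_) (sym |back|) (proj₁ period))
      (trans (cong (proj₁ u-end ++_) (sym u≡border++back)) (proj₂ u-end)))

  |border|<t : length border ℕ.< t
  |border|<t = subst (length border ℕ.<_) |s|≡t (unioccurrent-longer border-end border-occ s-unioccurrent)

  |u|≡p+|border| : toℚ (length u) ≡ toℚ p + toℚ (length border)
  |u|≡p+|border| = trans (cong (toℚ ∘ length) u≡front++border)
    (trans (cong toℚ (trans (length-++ front) (cong (ℕ._+ length border) |front|))) (toℚ-+ p (length border)))
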